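{- Every pure vertex decomposable simplicial complex is shelling completable.
   Context: A simplicial complex $\Delta$ on a finite ground set $V$ is a collection of subsets of $V$ closed under taking subsets; facets are inclusion-maximal faces; $\Delta$ is pure if all facets have the same cardinality; the dimension is the maximal facet cardinality minus one. A simplex is a complex of the form $2^W$, including the void complex $\emptyset$ and the empty complex $\{\emptyset\}$. $\mathrm{lk}_\Delta(v)=\{G\in\Delta: v\notin G,\ G\cup\{v\}\in\Delta\}$ and $\mathrm{del}_\Delta(v)=\{G\in\Delta: v\notin G\}$ (ground set $V\setminus\{v\}$). $\Delta$ is vertex decomposable if it is a simplex, or it has a vertex $v$ (i.e. $\{v\}\in\Delta$) such that $\mathrm{del}_\Delta(v)$ and $\mathrm{lk}_\Delta(v)$ are vertex decomposable and every facet of $\mathrm{del}_\Delta(v)$ is a facet of $\Delta$. A pure $d$-dimensional complex is shellable if its facets can be ordered $F_1,\dots,F_s$ so that for each $k\ge 2$ the complex generated by the sets $F_i\cap F_k$, $i<k$, is pure of dimension $d-1$ (the void and empty complexes are shellable). For a set $V$ with $|V|=n$, $\Delta_{n-1}^{(d)}$ denotes the complex whose facets are all $(d+1)$-subsets of $V$. A pure $d$-dimensional complex $\Delta$ with ground set $V$, $|V|=n$, is shelling completable if there is a shelling $F_1,\dots,F_s$ of $\Delta$ which is the initial segment of some shelling of $\Delta_{n-1}^{(d)}$. -}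

module Defs where

open import Data.Nat using (ℕ; _∸_)
open import Data.Fin using (Fin)
open import Data.Fin.Subset using (Subset; _⊆_; _∈_; _∉_; _∩_; _∪_; ⁅_⁆; ∣_∣)
open import Data.List using (List; []; _∷_; _++_; map)
open import Data.List.Relation.Unary.Any using (Any)
open import Data.List.Relation.Unary.Unique.Propositional using (Unique)
import Data.List.Membership.Propositional as LM
open import Data.Product using (Σ; _×_; Σ-syntax)
open import Data.Sum using (_⊎_)
open import Data.Empty using (⊥)
open import Relation.Nullary using (¬_)
open import Relation.Binary.PropositionalEquality using (_≡_; _≢_)
open import Function.Bundles using (_⇔_)

-- Ground set V = Fin n.  Faces are subsets of Fin n (Data.Fin.Subset).
-- A (candidate) complex is a predicate on subsets: Δ F means "F is a face".
Cx : ℕ → Set₁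
Cx n = Subset n → Set

IsComplex : ∀ {n} → Cx n → Set
IsComplex Δ = ∀ F G → G ⊆ F → Δ F → Δ G

Facet : ∀ {n} → Cx n → Subset n → Set
Facet Δ F = Δ F × (∀ G → Δ G → F ⊆ G → G ≡ F)

-- pure with all facets of cardinality k  (k = dimension + 1)
Pure : ∀ {n} → ℕ → Cx n → Set
Pure k Δ = ∀ F → Facet Δ F → ∣ F ∣ ≡ k

del : ∀ {n} → Cx n → Fin n → Cx n
del Δ v F = Δ F × v ∉ F

lk : ∀ {n} → Cx n → Fin n → Cx n
lk Δ v F = v ∉ F × Δ (F ∪ ⁅ v ⁆)

-- a simplex 2^W, including the void complex (no faces at all)
IsSimplex : ∀ {n} → Cx n → Set
IsSimplex {n} Δ = (∀ F → ¬ Δ F) ⊎ (Σ[ W ∈ Subset n ] (∀ F → Δ F ⇔ F ⊆ W))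

data VertexDecomposable {n} : Cx n → Set₁ where
  simplex : ∀ {Δ} → IsSimplex Δ → VertexDecomposable Δ
  decomp  : ∀ {Δ} (v : Fin n) → Δ ⁅ v ⁆
          → VertexDecomposable (del Δ v)
          → VertexDecomposable (lk Δ v)
          → (∀ F → Facet (del Δ v) F → Facet Δ F)
          → VertexDecomposable Δ

Gen : ∀ {n} → List (Subset n) → Cx n
Gen Hs G = Any (λ H → G ⊆ H) Hs

-- shelling condition for facets of cardinality k = d+1: for every position
-- with a nonempty prefix, the complex generated by F_i ∩ F_k (i < k) is pure
-- of dimension d-1 (facet cardinality k-1).
ShellCond : ∀ {n} → ℕ → List (Subset n) → Set
ShellCond {n} k Fs = ∀ (pre : List (Subset n)) (F : Subset n) (post : List (Subset n))
  → Fs ≡ pre ++ (F ∷ post) → pre ≢ []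
  → Pure (k ∸ 1) (Gen (map (λ H → H ∩ F) pre))

IsShellingOf : ∀ {n} → (Subset n → Set) → ℕ → List (Subset n) → Set
IsShellingOf isFacet k Fs =
  Unique Fs × (∀ F → (F LM.∈ Fs) ⇔ isFacet F) × ShellCond k Fs

-- facets of Δ_{n-1}^{(d)}: all (d+1)-subsets of the ground set, k = d+1
SkeletonFacet : ∀ {n} → ℕ → Subset n → Set
SkeletonFacet k F = ∣ F ∣ ≡ k

ShellingCompletable : ∀ {n} → ℕ → Cx n → Set
ShellingCompletable {n} k Δ =
  Σ[ Fs ∈ List (Subset n) ] Σ[ Gs ∈ List (Subset n) ]
    (IsShellingOf (Facet Δ) k Fs × IsShellingOf (SkeletonFacet k) k (Fs ++ Gs))

-- Induction along the vertex decomposition, carrying a shelling of all k-subsets of the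
-- ground set U whose initial segment is the list of facets of Δ.  For a shedding vertex v,
-- such orderings A₁ A₂ of the (k+1)-subsets of U - v (for the deletion) and B₁ B₂ of its
-- k-subsets (for the link) combine into A₁ (cone v B₁) A₂ (cone v B₂), and the shedding
-- condition makes A₁ (cone v B₁) exactly the facets of Δ.  A cone v G meets every earlier
-- set avoiding v inside the ridge G; a set of A₂ meets an earlier cone v G' inside a ridge
-- inherited from a facet of A₁ containing G'.  Simplices and the void complex are reached by
-- peeling off the vertices of U lying in no face, whose links are void.
module Submission where

open import Defs
open import Data.Nat using (ℕ; zero; suc; _∸_; _<_; _≤_)
import Data.Nat.Properties as ℕ
open import Data.Fin using (Fin; zero; suc; _≟_)
open import Data.Fin.Subset
  using (Subset; _∈_; _∉_; _⊆_; _∪_; _∩_; _─_; _-_; ⁅_⁆; ∣_∣; ⊤; inside; outside)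
  renaming (⊥ to ∅)
open import Data.Fin.Subset.Properties
  using ( x∈p∪q⁻; x∈p∩q⁺; x∈p∩q⁻; x∈⁅x⁆; x∈⁅y⁆⇒x≡y; x∈p∧x≢y⇒x∈p-y; p─q⊆p; p⊆p∪q; q⊆p∪q
        ; p∩q⊆q; ⊆-antisym; ⊆-trans; ⊆-reflexive; p⊆q⇒∣p∣≤∣q∣; ∪-identityʳ; ∪-identityˡ
        ; drop-there; out⊆; in⊆in; ⊥⊆; ⊆⊤; ⊆-refl; ∉⊥; ∣⊥∣≡0; _∈?_ )
open import Data.Vec.Base using (_∷_; []; here; there)
open import Data.List using (List; []; _∷_; _++_; _∷ʳ_; [_]; map)
open import Data.List.Properties using (++-assoc; ++-identityʳ; map-++; map-∘; map-id-local)
open import Data.List.Relation.Unary.All as All using (All; []; _∷_)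
import Data.List.Relation.Unary.All.Properties as AllP
import Data.List.Relation.Unary.Any as Any
import Data.List.Relation.Unary.Any.Properties as AnyP
open import Data.List.Relation.Unary.AllPairs using ([]; _∷_)
open import Data.List.Relation.Unary.Unique.Propositional using (Unique)
import Data.List.Relation.Unary.Unique.Propositional.Properties as Unique
open import Data.List.Membership.Propositional using (find) renaming (_∈_ to _∈ₗ_)
open import Data.List.Membership.Propositional.Properties
  using (∈-map⁺; ∈-map⁻; ∈-++⁺ˡ; ∈-++⁺ʳ; ∈-++⁻)
open import Data.List.Relation.Binary.Subset.Propositional using () renaming (_⊆_ to _⊆ₗ_)
open import Data.List.Relation.Binary.Permutation.Propositional
  using (_↭_; ↭-refl; ↭-sym; ↭⇒↭ₛ; module PermutationReasoning)
open import Data.List.Relation.Binary.Permutation.Propositional.Properties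
  using (∈-resp-↭; ++⁺ˡ; ++⁺ʳ; ++-comm)
import Data.List.Relation.Binary.Permutation.Setoid.Properties as Permutationₛ
open import Data.Product using (∃-syntax; _×_; _,_; proj₁; proj₂)
import Data.Product as Product
open import Data.Sum using (_⊎_; inj₁; inj₂; [_,_]′)
import Data.Sum as Sum
open import Data.Unit using (tt)
open import Data.Empty using (⊥)
open import Function using (id; _∘_; _$_)
open import Function.Bundles using (_⇔_; mk⇔; Equivalence)
import Function.Properties.Equivalence as ⇔
open import Relation.Nullary using (yes; no; contradiction)
open import Relation.Binary.PropositionalEquality
  using (_≡_; _≢_; refl; sym; trans; cong; subst; subst₂; setoid; module ≡-Reasoning)

private variable
  n k : ℕ
  x y v : Fin n
  p q F G H U W : Subset n
  Δ Δ' : Cx n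
  pa pb pc : List (Subset n)

x∈p─q⇒x∉q : x ∈ p ─ q → x ∉ q
x∈p─q⇒x∉q {p = inside ∷ _} {q = outside ∷ _} here ()
x∈p─q⇒x∉q {p = _ ∷ _} {q = _ ∷ _} (there x∈p─q) (there x∈q) = x∈p─q⇒x∉q x∈p─q x∈q

x∈p-y⇒x≢y : x ∈ p - y → x ≢ y
x∈p-y⇒x≢y {y = y} x∈p-y refl = x∈p─q⇒x∉q x∈p-y (x∈⁅x⁆ y)

x∉p-x : x ∉ p - x
x∉p-x x∈p-x = x∈p-y⇒x≢y x∈p-x refl

x∈p∪⁅y⁆⇒x∈p⊎x≡y : x ∈ p ∪ ⁅ y ⁆ → x ∈ p ⊎ x ≡ y
x∈p∪⁅y⁆⇒x∈p⊎x≡y {p = p} {y = y} x∈ = Sum.map₂ (x∈⁅y⁆⇒x≡y y) (x∈p∪q⁻ p ⁅ y ⁆ x∈)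

x∈p∪⁅x⁆ : ∀ (p : Subset n) x → x ∈ p ∪ ⁅ x ⁆
x∈p∪⁅x⁆ p x = q⊆p∪q p ⁅ x ⁆ (x∈⁅x⁆ x)

x∉p∧x≢y⇒x∉p∪⁅y⁆ : x ∉ p → x ≢ y → x ∉ p ∪ ⁅ y ⁆
x∉p∧x≢y⇒x∉p∪⁅y⁆ x∉p x≢y x∈ = [ x∉p , x≢y ]′ (x∈p∪⁅y⁆⇒x∈p⊎x≡y x∈)

⊆p∪⁅x⁆ : ∀ {r} → (∀ {y} → y ∈ r → y ≢ x → y ∈ p) → r ⊆ p ∪ ⁅ x ⁆
⊆p∪⁅x⁆ {x = x} {p = p} r-x⊆p {y} y∈r with y ≟ x
... | yes refl = x∈p∪⁅x⁆ p x
... | no y≢x   = p⊆p∪q ⁅ x ⁆ (r-x⊆p y∈r y≢x)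

x∈p∪⁅y⁆∧x≢y⇒x∈p : x ∈ p ∪ ⁅ y ⁆ → x ≢ y → x ∈ p
x∈p∪⁅y⁆∧x≢y⇒x∈p x∈ x≢y = [ id , (λ x≡y → contradiction x≡y x≢y) ]′ (x∈p∪⁅y⁆⇒x∈p⊎x≡y x∈)

p∪⁅x⁆⊆q : p ⊆ q → x ∈ q → p ∪ ⁅ x ⁆ ⊆ q
p∪⁅x⁆⊆q p⊆q x∈q y∈ = [ p⊆q , (λ { refl → x∈q }) ]′ (x∈p∪⁅y⁆⇒x∈p⊎x≡y y∈)

x∉p⇒∣p∪⁅x⁆∣≡1+∣p∣ : x ∉ p → ∣ p ∪ ⁅ x ⁆ ∣ ≡ suc ∣ p ∣
x∉p⇒∣p∪⁅x⁆∣≡1+∣p∣ {x = zero}  {p = outside ∷ p} _ = cong suc (cong ∣_∣ (∪-identityʳ p))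
x∉p⇒∣p∪⁅x⁆∣≡1+∣p∣ {x = zero}  {p = inside ∷ p} x∉p = contradiction here x∉p
x∉p⇒∣p∪⁅x⁆∣≡1+∣p∣ {x = suc x} {p = outside ∷ p} x∉p = x∉p⇒∣p∪⁅x⁆∣≡1+∣p∣ (x∉p ∘ there)
x∉p⇒∣p∪⁅x⁆∣≡1+∣p∣ {x = suc x} {p = inside ∷ p} x∉p = cong suc (x∉p⇒∣p∪⁅x⁆∣≡1+∣p∣ (x∉p ∘ there))

p∪⁅x⁆≡q : p ⊆ q → x ∈ q → (∀ {y} → y ∈ q → y ≢ x → y ∈ p) → p ∪ ⁅ x ⁆ ≡ q
p∪⁅x⁆≡q p⊆q x∈q q-x⊆p = ⊆-antisym (p∪⁅x⁆⊆q p⊆q x∈q) (⊆p∪⁅x⁆ q-x⊆p)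

1+∣p∣≡∣q∣ : p ⊆ q → x ∈ q → x ∉ p → (∀ {y} → y ∈ q → y ≢ x → y ∈ p) → suc ∣ p ∣ ≡ ∣ q ∣
1+∣p∣≡∣q∣ p⊆q x∈q x∉p q-x⊆p =
  trans (sym (x∉p⇒∣p∪⁅x⁆∣≡1+∣p∣ x∉p)) (cong ∣_∣ (p∪⁅x⁆≡q p⊆q x∈q q-x⊆p))

x∈p⇒p-x∪⁅x⁆≡p : x ∈ p → (p - x) ∪ ⁅ x ⁆ ≡ p
x∈p⇒p-x∪⁅x⁆≡p {p = p} x∈p = p∪⁅x⁆≡q (p─q⊆p p _) x∈p x∈p∧x≢y⇒x∈p-y

x∈p⇒1+∣p-x∣≡∣p∣ : x ∈ p → suc ∣ p - x ∣ ≡ ∣ p ∣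
x∈p⇒1+∣p-x∣≡∣p∣ {p = p} x∈p =
  1+∣p∣≡∣q∣ (p─q⊆p p _) x∈p x∉p-x x∈p∧x≢y⇒x∈p-y

x∉p⇒p∪⁅x⁆-x≡p : x ∉ p → (p ∪ ⁅ x ⁆) - x ≡ p
x∉p⇒p∪⁅x⁆-x≡p {x = x} {p = p} x∉p = ⊆-antisym
  (λ y∈ → x∈p∪⁅y⁆∧x≢y⇒x∈p (p─q⊆p _ _ y∈) (x∈p-y⇒x≢y y∈))
  (λ y∈p → x∈p∧x≢y⇒x∈p-y (p⊆p∪q ⁅ x ⁆ y∈p) (λ { refl → x∉p y∈p }))

⊆-or-∉ : ∀ (p q : Subset n) → p ⊆ q ⊎ ∃[ x ] x ∈ p × x ∉ q
⊆-or-∉ []      []      = inj₁ (λ ())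
⊆-or-∉ (s ∷ p) (t ∷ q) with ⊆-or-∉ p q | s | t
... | inj₂ (x , x∈p , x∉q) | _ | _ = inj₂ (suc x , there x∈p , x∉q ∘ drop-there)
... | inj₁ p⊆q | outside | _       = inj₁ (out⊆ p⊆q)
... | inj₁ p⊆q | inside  | inside  = inj₁ (in⊆in p⊆q)
... | inj₁ _   | inside  | outside = inj₂ (zero , here , λ ())

∣p∣<∣q∣⇒∃x∈q∖p : ∣ p ∣ < ∣ q ∣ → ∃[ x ] x ∈ q × x ∉ p
∣p∣<∣q∣⇒∃x∈q∖p {p = p} {q = q} ∣p∣<∣q∣ with ⊆-or-∉ q p
... | inj₁ q⊆p = contradiction (p⊆q⇒∣p∣≤∣q∣ q⊆p) (ℕ.<⇒≱ ∣p∣<∣q∣)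
... | inj₂ x∈q∖p = x∈q∖p

p⊆q∧∣p∣≡∣q∣⇒p≡q : p ⊆ q → ∣ p ∣ ≡ ∣ q ∣ → p ≡ q
p⊆q∧∣p∣≡∣q∣⇒p≡q {p = p} {q = q} p⊆q ∣p∣≡∣q∣ with ⊆-or-∉ q p
... | inj₁ q⊆p = ⊆-antisym p⊆q q⊆p
... | inj₂ (x , x∈q , x∉p) = contradiction ∣p∣≡∣q∣ (ℕ.<⇒≢ (begin-strict
  ∣ p ∣           <⟨ ℕ.n<1+n _ ⟩
  suc ∣ p ∣       ≡⟨ x∉p⇒∣p∪⁅x⁆∣≡1+∣p∣ x∉p ⟨
  ∣ p ∪ ⁅ x ⁆ ∣   ≤⟨ p⊆q⇒∣p∣≤∣q∣ (p∪⁅x⁆⊆q p⊆q x∈q) ⟩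
  ∣ q ∣           ∎))
  where open ℕ.≤-Reasoning

∣p∣≡0⇒p≡∅ : ∣ p ∣ ≡ 0 → p ≡ ∅
∣p∣≡0⇒p≡∅ {n} ∣p∣≡0 = sym (p⊆q∧∣p∣≡∣q∣⇒p≡q ⊥⊆ (trans (∣⊥∣≡0 n) (sym ∣p∣≡0)))

x∈p∧∣p∣≡1+m⇒∣p-x∣≡m : ∀ {m} → x ∈ p → ∣ p ∣ ≡ suc m → ∣ p - x ∣ ≡ m
x∈p∧∣p∣≡1+m⇒∣p-x∣≡m x∈p ∣p∣≡1+m = ℕ.suc-injective (trans (x∈p⇒1+∣p-x∣≡∣p∣ x∈p) ∣p∣≡1+m)

x∈p⇒∣p∣≢0 : x ∈ p → ∣ p ∣ ≢ 0
x∈p⇒∣p∣≢0 x∈p ∣p∣≡0 = ℕ.1+n≢0 (trans (x∈p⇒1+∣p-x∣≡∣p∣ x∈p) ∣p∣≡0)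

p⊆q-x⇒x∉p : p ⊆ q - x → x ∉ p
p⊆q-x⇒x∉p p⊆q-x x∈p = x∉p-x (p⊆q-x x∈p)

p⊆q∧x∉p⇒p⊆q-x : p ⊆ q → x ∉ p → p ⊆ q - x
p⊆q∧x∉p⇒p⊆q-x p⊆q x∉p y∈p = x∈p∧x≢y⇒x∈p-y (p⊆q y∈p) (λ { refl → x∉p y∈p })

Unique-resp-↭ : ∀ {A : Set} {xs ys : List A} → xs ↭ ys → Unique xs → Unique ys
Unique-resp-↭ xs↭ys = Permutationₛ.Unique-resp-↭ (setoid _) (↭⇒↭ₛ xs↭ys)

Unique-++⁻ˡ : ∀ {A : Set} (xs : List A) {ys} → Unique (xs ++ ys) → Unique xs
Unique-++⁻ˡ []       _                         = []
Unique-++⁻ˡ (x ∷ xs) (x∉xs++ys ∷ unique) = AllP.++⁻ˡ xs x∉xs++ys ∷ Unique-++⁻ˡ xs unique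

-- The shelling condition in exchange form: each new F meets every earlier H inside a
-- ridge F - x of F that lies in some earlier H'.

data Ridge (pre : List (Subset n)) (F H : Subset n) : Set where
  ridge : (x : Fin n) → x ∈ F → x ∉ H →
          (H' : Subset n) → H' ∈ₗ pre → x ∉ H' → (∀ {y} → y ∈ F → y ≢ x → y ∈ H') →
          Ridge pre F H

Attachable : List (Subset n) → Subset n → Set
Attachable pre F = ∀ {H} → H ∈ₗ pre → Ridge pre F H

Shells : List (Subset n) → List (Subset n) → Set
Shells acc []      = Data.Unit.⊤
Shells acc (F ∷ L) = Attachable acc F × Shells (acc ∷ʳ F) L

Ridge-mono : ∀ {pre pre'} → pre ⊆ₗ pre' → Ridge pre F H → Ridge pre' F H
Ridge-mono pre⊆pre' (ridge x x∈F x∉H H' H'∈pre x∉H' F-x⊆H') =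
  ridge x x∈F x∉H H' (pre⊆pre' H'∈pre) x∉H' F-x⊆H'

Shells-++⁺ : ∀ acc xs {ys : List (Subset n)} →
             Shells acc xs → Shells (acc ++ xs) ys → Shells acc (xs ++ ys)
Shells-++⁺ acc []       {ys} _ shells =
  subst (λ pre → Shells pre ys) (++-identityʳ acc) shells
Shells-++⁺ acc (x ∷ xs) {ys} (attach , shells) shells' =
  attach , Shells-++⁺ (acc ∷ʳ x) xs shells
             (subst (λ pre → Shells pre ys) (sym (++-assoc acc [ x ] xs)) shells')

Shells-++⁻ : ∀ acc xs {ys : List (Subset n)} →
             Shells acc (xs ++ ys) → Shells acc xs × Shells (acc ++ xs) ys
Shells-++⁻ acc []       {ys} shells =
  tt , subst (λ pre → Shells pre ys) (sym (++-identityʳ acc)) shells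
Shells-++⁻ acc (x ∷ xs) {ys} (attach , shells) =
  Product.map (attach ,_) (subst (λ pre → Shells pre ys) (++-assoc acc [ x ] xs))
              (Shells-++⁻ (acc ∷ʳ x) xs shells)

Shells⇒ShellCond : ∀ {L : List (Subset n)} → (∀ {F} → F ∈ₗ L → ∣ F ∣ ≡ k) →
                   Shells [] L → ShellCond k L
Shells⇒ShellCond {k = k} sizes shells pre F post refl _ X (X∈gen , X-max) =
  ridge-size (find (AnyP.map⁻ X∈gen))
  where
  ∣F∣≡k : ∣ F ∣ ≡ k
  ∣F∣≡k = sizes (∈-++⁺ʳ pre (Any.here refl))

  ridge-size : ∃[ H ] H ∈ₗ pre × X ⊆ H ∩ F → ∣ X ∣ ≡ k ∸ 1
  ridge-size (H , H∈pre , X⊆H∩F)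
    with proj₁ (proj₂ (Shells-++⁻ [] pre shells)) H∈pre
  ... | ridge x x∈F x∉H H' H'∈pre x∉H' F-x⊆H' = begin
    ∣ X ∣                  ≡⟨ cong ∣_∣ (X-max (H' ∩ F) H'∩F∈gen X⊆H'∩F) ⟨
    ∣ H' ∩ F ∣             ≡⟨ cong (_∸ 1) (trans ∣H'∩F∣+1≡∣F∣ ∣F∣≡k) ⟩
    k ∸ 1                  ∎
    where
    open ≡-Reasoning
    H'∩F∈gen : Gen (map (_∩ F) pre) (H' ∩ F)
    H'∩F∈gen = Any.map ⊆-reflexive (∈-map⁺ (_∩ F) H'∈pre)
    X⊆H'∩F : X ⊆ H' ∩ F
    X⊆H'∩F y∈X with x∈p∩q⁻ H F (X⊆H∩F y∈X)
    ... | y∈H , y∈F = x∈p∩q⁺ (F-x⊆H' y∈F (λ { refl → x∉H y∈H }) , y∈F)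
    ∣H'∩F∣+1≡∣F∣ : suc ∣ H' ∩ F ∣ ≡ ∣ F ∣
    ∣H'∩F∣+1≡∣F∣ = 1+∣p∣≡∣q∣ (p∩q⊆q H' F) x∈F (x∉H' ∘ proj₁ ∘ x∈p∩q⁻ H' F)
                              (λ y∈F y≢x → x∈p∩q⁺ (F-x⊆H' y∈F y≢x , y∈F))

cone : Fin n → Subset n → Subset n
cone v G = G ∪ ⁅ v ⁆

record Merged (v : Fin n) (pa pb pc : List (Subset n)) : Set where
  constructor merge
  field permutation : pc ↭ pa ++ map (cone v) pb

Covered : List (Subset n) → List (Subset n) → Set
Covered xs ys = ∀ {G} → G ∈ₗ xs → ∃[ H ] H ∈ₗ ys × G ⊆ H

module _ (v : Fin n) where
  open PermutationReasoning

  Merged-free : ∀ L → Merged v pa pb pc → Merged v (pa ++ L) pb (pc ++ L)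
  Merged-free {pa = pa} {pb = pb} {pc = pc} L (merge pc↭) = merge $ begin
    pc ++ L                       ↭⟨ ++⁺ʳ L pc↭ ⟩
    (pa ++ map (cone v) pb) ++ L  ≡⟨ ++-assoc pa _ L ⟩
    pa ++ map (cone v) pb ++ L    ↭⟨ ++⁺ˡ pa (++-comm (map (cone v) pb) L) ⟩
    pa ++ L ++ map (cone v) pb    ≡⟨ ++-assoc pa L _ ⟨
    (pa ++ L) ++ map (cone v) pb  ∎

  Merged-cone : ∀ L → Merged v pa pb pc → Merged v pa (pb ++ L) (pc ++ map (cone v) L)
  Merged-cone {pa = pa} {pb = pb} {pc = pc} L (merge pc↭) = merge $ begin
    pc ++ map (cone v) L                          ↭⟨ ++⁺ʳ _ pc↭ ⟩
    (pa ++ map (cone v) pb) ++ map (cone v) L     ≡⟨ ++-assoc pa _ _ ⟩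
    pa ++ map (cone v) pb ++ map (cone v) L       ≡⟨ cong (pa ++_) (map-++ (cone v) pb L) ⟨
    pa ++ map (cone v) (pb ++ L)                  ∎

  Merged-∈⁻ : Merged v pa pb pc → H ∈ₗ pc → H ∈ₗ pa ⊎ ∃[ G ] G ∈ₗ pb × H ≡ cone v G
  Merged-∈⁻ {pa = pa} (merge pc↭) H∈pc =
    Sum.map₂ (∈-map⁻ (cone v)) (∈-++⁻ pa (∈-resp-↭ pc↭ H∈pc))

  Merged-∈ˡ : Merged v pa pb pc → pa ⊆ₗ pc
  Merged-∈ˡ (merge pc↭) H∈pa = ∈-resp-↭ (↭-sym pc↭) (∈-++⁺ˡ H∈pa)

  Merged-∈ʳ : Merged v pa pb pc → G ∈ₗ pb → cone v G ∈ₗ pc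
  Merged-∈ʳ {pa = pa} (merge pc↭) G∈pb =
    ∈-resp-↭ (↭-sym pc↭) (∈-++⁺ʳ pa (∈-map⁺ (cone v) G∈pb))

  attach-free : Merged v pa pb pc → v ∉ F → Covered pb pa →
                Attachable pa F → Attachable pc F
  attach-free merged v∉F pb⊑pa attach H∈pc with Merged-∈⁻ merged H∈pc
  ... | inj₁ H∈pa = Ridge-mono (Merged-∈ˡ merged) (attach H∈pa)
  ... | inj₂ (G , G∈pb , refl) with pb⊑pa G∈pb
  ...   | H₀ , H₀∈pa , G⊆H₀ with attach H₀∈pa
  ...     | ridge x x∈F x∉H₀ H' H'∈pa x∉H' F-x⊆H' =
    ridge x x∈F (x∉p∧x≢y⇒x∉p∪⁅y⁆ (x∉H₀ ∘ G⊆H₀) (λ { refl → v∉F x∈F }))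
          H' (Merged-∈ˡ merged H'∈pa) x∉H' F-x⊆H'

  attach-cone : Merged v pa pb pc → (∀ {H} → H ∈ₗ pa → v ∉ H) → v ∉ G →
                (∀ {H} → H ∈ₗ pa → ∃[ H' ] H' ∈ₗ pa × G ⊆ H') →
                Attachable pb G → Attachable pc (cone v G)
  attach-cone {G = G} merged pa-avoids v∉G covered attach H∈pc with Merged-∈⁻ merged H∈pc
  ... | inj₁ H∈pa with covered H∈pa
  ...   | H' , H'∈pa , G⊆H' =
    ridge v (x∈p∪⁅x⁆ G v) (pa-avoids H∈pa) H' (Merged-∈ˡ merged H'∈pa) (pa-avoids H'∈pa)
          (λ y∈ y≢v → G⊆H' (x∈p∪⁅y⁆∧x≢y⇒x∈p y∈ y≢v))
  attach-cone merged pa-avoids v∉G covered attach H∈pc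
    | inj₂ (G' , G'∈pb , refl) with attach G'∈pb
  ...   | ridge x x∈G x∉G' H' H'∈pb x∉H' G-x⊆H' =
    ridge x (p⊆p∪q ⁅ v ⁆ x∈G) (x∉p∧x≢y⇒x∉p∪⁅y⁆ x∉G' x≢v)
          (cone v H') (Merged-∈ʳ merged H'∈pb) (x∉p∧x≢y⇒x∉p∪⁅y⁆ x∉H' x≢v)
          (λ y∈ y≢x → [ (λ y∈G → p⊆p∪q ⁅ v ⁆ (G-x⊆H' y∈G y≢x)) , (λ { refl → x∈p∪⁅x⁆ H' v }) ]′
                         (x∈p∪⁅y⁆⇒x∈p⊎x≡y y∈))
    where
    x≢v : x ≢ v
    x≢v refl = v∉G x∈G

  free-block : ∀ L → Merged v pa pb pc → All (v ∉_) L → Covered pb pa →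
               Shells pa L → Shells pc L
  free-block []      _      _                _     _                 = tt
  free-block (F ∷ L) merged (v∉F ∷ avoids) pb⊑pa (attach , shells) =
    attach-free merged v∉F pb⊑pa attach ,
    free-block L (Merged-free [ F ] merged) avoids
               (Product.map₂ (Product.map₁ ∈-++⁺ˡ) ∘ pb⊑pa) shells

  cone-block : ∀ L → Merged v pa pb pc → (∀ {H} → H ∈ₗ pa → v ∉ H) →
               All (λ G → v ∉ G × (∀ {H} → H ∈ₗ pa → ∃[ H' ] H' ∈ₗ pa × G ⊆ H')) L →
               Shells pb L → Shells pc (map (cone v) L)
  cone-block []      _      _         _                          _                 = tt
  cone-block (G ∷ L) merged pa-avoids ((v∉G , covered) ∷ conds) (attach , shells) =
    attach-cone merged pa-avoids v∉G covered attach ,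
    cone-block L (Merged-cone [ G ] merged) pa-avoids conds shells

-- face⊆facet strengthens the induction: it is how cones over the link attach to the
-- facets of the deletion.
record Completion (U : Subset n) (k : ℕ) (Δ : Cx n) : Set where
  field
    facets others : List (Subset n)
    unique        : Unique (facets ++ others)
    ∈⇒k-subset    : ∀ {F} → F ∈ₗ facets ++ others → F ⊆ U × ∣ F ∣ ≡ k
    k-subset⇒∈    : ∀ {F} → F ⊆ U → ∣ F ∣ ≡ k → F ∈ₗ facets ++ others
    shells        : Shells [] (facets ++ others)
    ∈⇒facet       : ∀ {F} → F ∈ₗ facets → Facet Δ F
    facet⇒∈       : ∀ {F} → Facet Δ F → F ∈ₗ facets
    face⊆facet    : ∀ {G} → Δ G → ∃[ H ] H ∈ₗ facets × G ⊆ H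

Facet-resp-⇔ : (∀ {F} → Δ F ⇔ Δ' F) → Facet Δ F → Facet Δ' F
Facet-resp-⇔ Δ⇔Δ' (ΔF , F-max) =
  Equivalence.to Δ⇔Δ' ΔF , λ G Δ'G → F-max G (Equivalence.from Δ⇔Δ' Δ'G)

Completion-resp-⇔ : (∀ {F} → Δ F ⇔ Δ' F) → Completion U k Δ → Completion U k Δ'
Completion-resp-⇔ Δ⇔Δ' C = record
  { facets     = facets
  ; others     = others
  ; unique     = unique
  ; ∈⇒k-subset = ∈⇒k-subset
  ; k-subset⇒∈ = k-subset⇒∈
  ; shells     = shells
  ; ∈⇒facet    = Facet-resp-⇔ Δ⇔Δ' ∘ ∈⇒facet
  ; facet⇒∈    = facet⇒∈ ∘ Facet-resp-⇔ (⇔.sym Δ⇔Δ')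
  ; face⊆facet = face⊆facet ∘ Equivalence.from Δ⇔Δ'
  }
  where open Completion C

del-complex : IsComplex Δ → IsComplex (del Δ v)
del-complex Δ-complex F G G⊆F (ΔF , v∉F) = Δ-complex F G G⊆F ΔF , v∉F ∘ G⊆F

lk-complex : IsComplex Δ → IsComplex (lk Δ v)
lk-complex {v = v} Δ-complex F G G⊆F (v∉F , ΔvF) =
  v∉F ∘ G⊆F ,
  Δ-complex (cone v F) (cone v G) (⊆p∪⁅x⁆ (λ y∈ y≢v → G⊆F (x∈p∪⁅y⁆∧x≢y⇒x∈p y∈ y≢v))) ΔvF

lk-face⇒face : IsComplex Δ → lk Δ v G → Δ G
lk-face⇒face {v = v} {G = G} Δ-complex (_ , ΔvG) = Δ-complex (cone v G) G (p⊆p∪q ⁅ v ⁆) ΔvG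

del-facet : Facet Δ F → v ∉ F → Facet (del Δ v) F
del-facet (ΔF , F-max) v∉F = (ΔF , v∉F) , λ G (ΔG , _) → F-max G ΔG

face⇒lk-face : Δ F → v ∈ F → lk Δ v (F - v)
face⇒lk-face {Δ = Δ} ΔF v∈F = x∉p-x , subst Δ (sym (x∈p⇒p-x∪⁅x⁆≡p v∈F)) ΔF

lk-facet : Facet Δ F → v ∈ F → Facet (lk Δ v) (F - v)
lk-facet {Δ = Δ} {F = F} {v = v} (ΔF , F-max) v∈F =
  face⇒lk-face {Δ = Δ} ΔF v∈F ,
  λ X (v∉X , ΔvX) F-v⊆X → begin
    X                ≡⟨ x∉p⇒p∪⁅x⁆-x≡p v∉X ⟨
    cone v X - v     ≡⟨ cong (_- v) (F-max (cone v X) ΔvX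
                          (⊆p∪⁅x⁆ (λ y∈F y≢v → F-v⊆X (x∈p∧x≢y⇒x∈p-y y∈F y≢v)))) ⟩
    F - v            ∎
  where open ≡-Reasoning

cone-facet : Facet (lk Δ v) G → Facet Δ (cone v G)
cone-facet {Δ = Δ} {v = v} {G = G} ((v∉G , ΔvG) , G-max) = ΔvG , λ X ΔX vG⊆X →
  let v∈X = vG⊆X (x∈p∪⁅x⁆ G v) in begin
    X                ≡⟨ x∈p⇒p-x∪⁅x⁆≡p v∈X ⟨
    cone v (X - v)   ≡⟨ cong (cone v) (G-max (X - v)
                          (face⇒lk-face {Δ = Δ} ΔX v∈X)
                          (p⊆q∧x∉p⇒p⊆q-x (vG⊆X ∘ p⊆p∪q ⁅ v ⁆) v∉G)) ⟩
    cone v G         ∎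
  where open ≡-Reasoning

cone-facet-size : Pure k Δ → Facet (lk Δ v) G → suc ∣ G ∣ ≡ k
cone-facet-size {v = v} pure G-facet@((v∉G , _) , _) =
  trans (sym (x∉p⇒∣p∪⁅x⁆∣≡1+∣p∣ v∉G)) (pure _ (cone-facet G-facet))

cones-unique : ∀ {xs} → All (v ∉_) xs → Unique xs → Unique (map (cone v) xs)
cones-unique {v = v} {xs = xs} avoid unique = Unique.map⁻ (subst Unique (sym uncone) unique)
  where
  uncone : map (_- v) (map (cone v) xs) ≡ xs
  uncone = trans (sym (map-∘ xs)) (map-id-local (All.map x∉p⇒p∪⁅x⁆-x≡p avoid))

module _ {U : Subset n} {v : Fin n} {k : ℕ} {Δ : Cx n}
         (v∈U : v ∈ U) (Δ-complex : IsComplex Δ)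
         (del-facet⇒facet : ∀ F → Facet (del Δ v) F → Facet Δ F)
         (D : Completion (U - v) (suc k) (del Δ v))
         (L : Completion (U - v) k (lk Δ v)) where

  private
    module D = Completion D
    module L = Completion L

    A₁ A₂ A B₁ B₂ B Fs Gs : List (Subset n)
    A₁ = D.facets
    A₂ = D.others
    A  = A₁ ++ A₂
    B₁ = L.facets
    B₂ = L.others
    B  = B₁ ++ B₂
    Fs = A₁ ++ map (cone v) B₁
    Gs = A₂ ++ map (cone v) B₂

    A-avoids : ∀ {H} → H ∈ₗ A → v ∉ H
    A-avoids = p⊆q-x⇒x∉p ∘ proj₁ ∘ D.∈⇒k-subset

    B-avoids : ∀ {G} → G ∈ₗ B → v ∉ G
    B-avoids = p⊆q-x⇒x∉p ∘ proj₁ ∘ L.∈⇒k-subset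

    B₁⊑A₁ : Covered B₁ A₁
    B₁⊑A₁ G∈B₁ with L.∈⇒facet G∈B₁
    ... | lkG@(v∉G , _) , _ = D.face⊆facet (lk-face⇒face Δ-complex lkG , v∉G)

    B₂-extends : ∀ {G} → G ∈ₗ B₂ → ∀ {H} → H ∈ₗ A → ∃[ H' ] H' ∈ₗ A × G ⊆ H'
    B₂-extends {G} G∈B₂ {H} H∈A
      with L.∈⇒k-subset (∈-++⁺ʳ B₁ G∈B₂) | D.∈⇒k-subset H∈A
    ... | G⊆U-v , ∣G∣≡k | H⊆U-v , ∣H∣≡1+k
      with ∣p∣<∣q∣⇒∃x∈q∖p {p = G} {q = H} (subst₂ _<_ (sym ∣G∣≡k) (sym ∣H∣≡1+k) (ℕ.n<1+n k))
    ...   | y , y∈H , y∉G =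
      cone y G ,
      D.k-subset⇒∈ (p∪⁅x⁆⊆q G⊆U-v (H⊆U-v y∈H))
                   (trans (x∉p⇒∣p∪⁅x⁆∣≡1+∣p∣ y∉G) (cong suc ∣G∣≡k)) ,
      p⊆p∪q ⁅ y ⁆

    merged₁ : Merged v A₁ [] A₁
    merged₁ = Merged-free v A₁ (merge ↭-refl)

    merged₂ : Merged v A₁ B₁ Fs
    merged₂ = Merged-cone v B₁ merged₁

    merged₃ : Merged v A B₁ (Fs ++ A₂)
    merged₃ = Merged-free v A₂ merged₂

    merged : Merged v A B (Fs ++ Gs)
    merged = subst (Merged v A B) (++-assoc Fs A₂ _) (Merged-cone v B₂ merged₃)

    shells : Shells [] (Fs ++ Gs)
    shells = Shells-++⁺ [] Fs (Shells-++⁺ [] A₁ (proj₁ A-split) B₁-cones)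
                              (Shells-++⁺ Fs A₂ A₂-shells B₂-cones)
      where
      A-split : Shells [] A₁ × Shells A₁ A₂
      A-split = Shells-++⁻ [] A₁ D.shells
      B-split : Shells [] B₁ × Shells B₁ B₂
      B-split = Shells-++⁻ [] B₁ L.shells

      B₁-cones : Shells A₁ (map (cone v) B₁)
      B₁-cones = cone-block v B₁ merged₁ (A-avoids ∘ ∈-++⁺ˡ)
        (All.tabulate (λ G∈B₁ → B-avoids (∈-++⁺ˡ G∈B₁) , λ _ → B₁⊑A₁ G∈B₁))
        (proj₁ B-split)

      A₂-shells : Shells Fs A₂
      A₂-shells = free-block v A₂ merged₂ (All.tabulate (A-avoids ∘ ∈-++⁺ʳ A₁)) B₁⊑A₁
        (proj₂ A-split)

      B₂-cones : Shells (Fs ++ A₂) (map (cone v) B₂)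
      B₂-cones = cone-block v B₂ merged₃ A-avoids
        (All.tabulate (λ G∈B₂ → B-avoids (∈-++⁺ʳ B₁ G∈B₂) , B₂-extends G∈B₂))
        (proj₂ B-split)

    A⊥cones : ∀ {H} → H ∈ₗ A → H ∈ₗ map (cone v) B → ⊥
    A⊥cones H∈A H∈cones with ∈-map⁻ (cone v) H∈cones
    ... | G , _ , refl = A-avoids H∈A (x∈p∪⁅x⁆ G v)

    unique : Unique (Fs ++ Gs)
    unique = Unique-resp-↭ (↭-sym (Merged.permutation merged))
      (Unique.++⁺ D.unique (cones-unique (All.tabulate B-avoids) L.unique)
                  (λ (H∈A , H∈cones) → A⊥cones H∈A H∈cones))

    ∈⇒k-subset : ∀ {F} → F ∈ₗ Fs ++ Gs → F ⊆ U × ∣ F ∣ ≡ suc k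
    ∈⇒k-subset F∈ with Merged-∈⁻ v merged F∈
    ... | inj₁ F∈A with D.∈⇒k-subset F∈A
    ...   | F⊆U-v , ∣F∣≡1+k = ⊆-trans F⊆U-v (p─q⊆p U _) , ∣F∣≡1+k
    ∈⇒k-subset F∈ | inj₂ (G , G∈B , refl) with L.∈⇒k-subset G∈B
    ...   | G⊆U-v , ∣G∣≡k =
      p∪⁅x⁆⊆q (⊆-trans G⊆U-v (p─q⊆p U _)) v∈U ,
      trans (x∉p⇒∣p∪⁅x⁆∣≡1+∣p∣ (p⊆q-x⇒x∉p G⊆U-v)) (cong suc ∣G∣≡k)

    k-subset⇒∈ : ∀ {F} → F ⊆ U → ∣ F ∣ ≡ suc k → F ∈ₗ Fs ++ Gs
    k-subset⇒∈ {F} F⊆U ∣F∣≡1+k with v ∈? F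
    ... | no v∉F = Merged-∈ˡ v merged (D.k-subset⇒∈ (p⊆q∧x∉p⇒p⊆q-x F⊆U v∉F) ∣F∣≡1+k)
    ... | yes v∈F = subst (_∈ₗ Fs ++ Gs) (x∈p⇒p-x∪⁅x⁆≡p v∈F)
      (Merged-∈ʳ v merged (L.k-subset⇒∈
        (p⊆q∧x∉p⇒p⊆q-x (⊆-trans (p─q⊆p F _) F⊆U) x∉p-x)
        (x∈p∧∣p∣≡1+m⇒∣p-x∣≡m v∈F ∣F∣≡1+k)))

    ∈⇒facet : ∀ {F} → F ∈ₗ Fs → Facet Δ F
    ∈⇒facet F∈ with ∈-++⁻ A₁ F∈
    ... | inj₁ F∈A₁ = del-facet⇒facet _ (D.∈⇒facet F∈A₁)
    ... | inj₂ F∈cones with ∈-map⁻ (cone v) F∈cones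
    ...   | G , G∈B₁ , refl = cone-facet (L.∈⇒facet G∈B₁)

    facet⇒∈ : ∀ {F} → Facet Δ F → F ∈ₗ Fs
    facet⇒∈ {F} F-facet with v ∈? F
    ... | no v∉F = ∈-++⁺ˡ (D.facet⇒∈ (del-facet F-facet v∉F))
    ... | yes v∈F = ∈-++⁺ʳ A₁ (subst (_∈ₗ map (cone v) B₁) (x∈p⇒p-x∪⁅x⁆≡p v∈F)
                                     (∈-map⁺ (cone v) (L.facet⇒∈ (lk-facet F-facet v∈F))))

    face⊆facet : ∀ {G} → Δ G → ∃[ H ] H ∈ₗ Fs × G ⊆ H
    face⊆facet {G} ΔG with v ∈? G
    ... | no v∉G = Product.map₂ (Product.map₁ ∈-++⁺ˡ) (D.face⊆facet (ΔG , v∉G))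
    ... | yes v∈G with L.face⊆facet (face⇒lk-face {Δ = Δ} ΔG v∈G)
    ...   | H , H∈B₁ , G-v⊆H =
      cone v H , ∈-++⁺ʳ A₁ (∈-map⁺ (cone v) H∈B₁) ,
      ⊆p∪⁅x⁆ (λ y∈G y≢v → G-v⊆H (x∈p∧x≢y⇒x∈p-y y∈G y≢v))

  Completion-from-del-lk : Completion U (suc k) Δ
  Completion-from-del-lk = record
    { facets     = Fs
    ; others     = Gs
    ; unique     = unique
    ; ∈⇒k-subset = ∈⇒k-subset
    ; k-subset⇒∈ = k-subset⇒∈
    ; shells     = shells
    ; ∈⇒facet    = ∈⇒facet
    ; facet⇒∈    = facet⇒∈
    ; face⊆facet = face⊆facet
    }

Void : Cx n
Void _ = ⊥

sole-k-subset-completion : W ⊆ U → ∣ W ∣ ≡ k → (∀ {F} → F ⊆ U → ∣ F ∣ ≡ k → F ≡ W) →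
                           Completion U k (_⊆ W)
sole-k-subset-completion {W = W} W⊆U ∣W∣≡k sole = record
  { facets     = [ W ]
  ; others     = []
  ; unique     = [] ∷ []
  ; ∈⇒k-subset = λ { (Any.here refl) → W⊆U , ∣W∣≡k }
  ; k-subset⇒∈ = λ F⊆U ∣F∣≡k → Any.here (sole F⊆U ∣F∣≡k)
  ; shells     = (λ ()) , tt
  ; ∈⇒facet    = λ { (Any.here refl) → ⊆-refl , λ G G⊆W W⊆G → ⊆-antisym G⊆W W⊆G }
  ; facet⇒∈    = λ (F⊆W , F-max) → Any.here (sym (F-max W ⊆-refl F⊆W))
  ; face⊆facet = λ G⊆W → W , Any.here refl , G⊆W
  }

Completion-add-nonvertex : v ∈ U → IsComplex Δ → (∀ {F} → Δ F → v ∉ F) →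
                           Completion (U - v) (suc k) Δ → Completion (U - v) k Void →
                           Completion U (suc k) Δ
Completion-add-nonvertex {v = v} {Δ = Δ} v∈U Δ-complex avoids D L =
  Completion-from-del-lk v∈U Δ-complex (λ _ → Facet-resp-⇔ del⇔Δ)
    (Completion-resp-⇔ (⇔.sym del⇔Δ) D) (Completion-resp-⇔ Void⇔lk L)
  where
  del⇔Δ : ∀ {F} → del Δ v F ⇔ Δ F
  del⇔Δ = mk⇔ proj₁ (λ ΔF → ΔF , avoids ΔF)
  Void⇔lk : ∀ {F} → Void F ⇔ lk Δ v F
  Void⇔lk {F} = mk⇔ (λ ()) (λ (_ , ΔvF) → avoids ΔvF (x∈p∪⁅x⁆ F v))

void-completion : ∀ m {U : Subset n} → ∣ U ∣ ≡ m → ∀ k → Completion U k Void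
void-completion {n} _ _ zero = record
  { facets     = []
  ; others     = [ ∅ ]
  ; unique     = [] ∷ []
  ; ∈⇒k-subset = λ { (Any.here refl) → ⊥⊆ , ∣⊥∣≡0 n }
  ; k-subset⇒∈ = λ _ ∣F∣≡0 → Any.here (∣p∣≡0⇒p≡∅ ∣F∣≡0)
  ; shells     = (λ ()) , tt
  ; ∈⇒facet    = λ ()
  ; facet⇒∈    = λ { (() , _) }
  ; face⊆facet = λ ()
  }
void-completion zero ∣U∣≡0 (suc k) = record
  { facets     = []
  ; others     = []
  ; unique     = []
  ; ∈⇒k-subset = λ ()
  ; k-subset⇒∈ = λ F⊆U ∣F∣≡1+k →
      contradiction (subst₂ _≤_ ∣F∣≡1+k ∣U∣≡0 (p⊆q⇒∣p∣≤∣q∣ F⊆U)) λ ()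
  ; shells     = tt
  ; ∈⇒facet    = λ ()
  ; facet⇒∈    = λ { (() , _) }
  ; face⊆facet = λ ()
  }
void-completion {n} (suc m) {U} ∣U∣≡1+m (suc k)
  with ∣p∣<∣q∣⇒∃x∈q∖p {p = ∅} {q = U} (subst₂ _<_ (sym (∣⊥∣≡0 n)) (sym ∣U∣≡1+m) ℕ.0<1+n)
... | v , v∈U , _ =
  Completion-add-nonvertex v∈U (λ _ _ _ ()) (λ ())
    (void-completion m ∣U-v∣≡m (suc k)) (void-completion m ∣U-v∣≡m k)
  where
  ∣U-v∣≡m : ∣ U - v ∣ ≡ m
  ∣U-v∣≡m = x∈p∧∣p∣≡1+m⇒∣p-x∣≡m v∈U ∣U∣≡1+m

simplex-completion : ∀ m {U W : Subset n} → ∣ U ∣ ≡ m → W ⊆ U →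
                     ∀ k → ∣ W ∣ ≡ k → Completion U k (_⊆ W)
simplex-completion _ _ W⊆U zero ∣W∣≡0 = sole-k-subset-completion W⊆U ∣W∣≡0
  (λ _ ∣F∣≡0 → trans (∣p∣≡0⇒p≡∅ ∣F∣≡0) (sym (∣p∣≡0⇒p≡∅ ∣W∣≡0)))
simplex-completion m {U} {W} ∣U∣≡m W⊆U (suc k) ∣W∣≡1+k with ⊆-or-∉ U W
... | inj₁ U⊆W = sole-k-subset-completion W⊆U ∣W∣≡1+k
  (λ F⊆U ∣F∣≡1+k → trans (p⊆q∧∣p∣≡∣q∣⇒p≡q F⊆U (trans ∣F∣≡1+k (trans (sym ∣W∣≡1+k) (cong ∣_∣ W≡U))))
                         (sym W≡U))
  where
  W≡U : W ≡ U
  W≡U = ⊆-antisym W⊆U U⊆W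
... | inj₂ (v , v∈U , v∉W) with m
...   | zero   = contradiction ∣U∣≡m (x∈p⇒∣p∣≢0 v∈U)
...   | suc m' =
  Completion-add-nonvertex v∈U (λ F G G⊆F F⊆W → ⊆-trans G⊆F F⊆W) (λ F⊆W v∈F → v∉W (F⊆W v∈F))
    (simplex-completion m' ∣U-v∣≡m' (p⊆q∧x∉p⇒p⊆q-x W⊆U v∉W) (suc k) ∣W∣≡1+k)
    (void-completion m' ∣U-v∣≡m' k)
  where
  ∣U-v∣≡m' : ∣ U - v ∣ ≡ m'
  ∣U-v∣≡m' = x∈p∧∣p∣≡1+m⇒∣p-x∣≡m v∈U ∣U∣≡m

lk-pure : Pure k Δ → Pure (k ∸ 1) (lk Δ v)
lk-pure pure G G-facet = cong (_∸ 1) (cone-facet-size pure G-facet)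

link-completion-size : ∀ {j} → Pure k Δ → Δ ⁅ v ⁆ → Completion U j (lk Δ v) → k ≡ suc j
link-completion-size {Δ = Δ} {v = v} pure Δv L =
  let H , H∈L , _ = L.face⊆facet ∅∈lk in
  trans (sym (cone-facet-size pure (L.∈⇒facet H∈L)))
        (cong suc (proj₂ (L.∈⇒k-subset (∈-++⁺ˡ H∈L))))
  where
  module L = Completion L
  ∅∈lk : lk Δ v ∅
  ∅∈lk = ∉⊥ , subst Δ (sym (∪-identityˡ ⁅ v ⁆)) Δv

VertexDecomposable⇒Completion : IsComplex Δ → Pure k Δ → (∀ {G} → Δ G → G ⊆ U) →
                                VertexDecomposable Δ → Completion U k Δ
VertexDecomposable⇒Completion {k = k} _ _ _ (simplex (inj₁ void)) =
  Completion-resp-⇔ (mk⇔ (λ ()) (void _)) (void-completion _ refl k)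
VertexDecomposable⇒Completion {Δ = Δ} {k = k} _ pure Δ⊆U (simplex (inj₂ (W , Δ⇔⊆W))) =
  Completion-resp-⇔ (λ {F} → ⇔.sym (Δ⇔⊆W F)) (simplex-completion _ refl (Δ⊆U ΔW) k ∣W∣≡k)
  where
  ΔW : Δ W
  ΔW = Equivalence.from (Δ⇔⊆W W) ⊆-refl
  ∣W∣≡k : ∣ W ∣ ≡ k
  ∣W∣≡k = pure W (ΔW , λ G ΔG W⊆G → ⊆-antisym (Equivalence.to (Δ⇔⊆W G) ΔG) W⊆G)
VertexDecomposable⇒Completion {Δ = Δ} {k = k} {U = U} Δ-complex pure Δ⊆U
                              (decomp v Δv del-vd lk-vd del-facet⇒facet) =
  subst (λ j → Completion U j Δ) (sym k≡1+[k∸1])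
    (Completion-from-del-lk (Δ⊆U Δv (x∈⁅x⁆ v)) Δ-complex del-facet⇒facet D L)
  where
  L : Completion (U - v) (k ∸ 1) (lk Δ v)
  L = VertexDecomposable⇒Completion (lk-complex Δ-complex) (lk-pure pure)
        (λ (v∉G , ΔvG) → p⊆q∧x∉p⇒p⊆q-x (⊆-trans (p⊆p∪q ⁅ v ⁆) (Δ⊆U ΔvG)) v∉G) lk-vd
  k≡1+[k∸1] : k ≡ suc (k ∸ 1)
  k≡1+[k∸1] = link-completion-size pure Δv L
  D : Completion (U - v) (suc (k ∸ 1)) (del Δ v)
  D = VertexDecomposable⇒Completion (del-complex Δ-complex)
        (λ F F-facet → trans (pure F (del-facet⇒facet F F-facet)) k≡1+[k∸1])
        (λ (ΔG , v∉G) → p⊆q∧x∉p⇒p⊆q-x (Δ⊆U ΔG) v∉G) del-vd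

Completion⇒ShellingCompletable : Completion ⊤ k Δ → ShellingCompletable k Δ
Completion⇒ShellingCompletable C =
  facets , others ,
  ( Unique-++⁻ˡ facets unique
  , (λ _ → mk⇔ ∈⇒facet facet⇒∈)
  , Shells⇒ShellCond (proj₂ ∘ ∈⇒k-subset ∘ ∈-++⁺ˡ) (proj₁ (Shells-++⁻ [] facets shells))) ,
  ( unique
  , (λ _ → mk⇔ (proj₂ ∘ ∈⇒k-subset) (k-subset⇒∈ ⊆⊤))
  , Shells⇒ShellCond (proj₂ ∘ ∈⇒k-subset) shells)
  where open Completion C

corollary2p11 : (n : ℕ) (Δ : Subset n → Set) → IsComplex Δ → (k : ℕ) → Pure k Δ → VertexDecomposable Δ → ShellingCompletable k Δ
corollary2p11 n Δ Δ-complex k pure vd =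
  Completion⇒ShellingCompletable (VertexDecomposable⇒Completion Δ-complex pure (λ _ → ⊆⊤) vd)
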